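{- Let $M=p_1^{n_1}\cdots p_K^{n_K}$ with distinct primes and $n_\nu\in\mathbb{N}$, let $A\oplus B=\mathbb{Z}_M$, and fix $i$. Assume that $0\in B$, and that $a_0\neq a_1\in A$ satisfy $p_i^{n_i}\mid a_0-a_1$. Assume further that $a_\mu*F_i$ splits with parity $(B,A)$ for $\mu=0,1$. Then $\Sigma_A(a_0*F_i)$ and $\Sigma_A(a_1*F_i)$ are disjoint.
   Context: $A\oplus B=\mathbb{Z}_M$ means every element of $\mathbb{Z}_M$ is uniquely $a+b$ with $a\in A,b\in B$. $F_i=\{0,M/p_i,\dots,(p_i-1)M/p_i\}$ and $x*F_i=\{x+f:f\in F_i\}$. For $Z\subset\mathbb{Z}_M$, $\Sigma_A(Z)=\{a\in A:a+b\in Z\text{ for some }b\in B\}$, $\Sigma_B(Z)=\{b\in B:a+b\in Z\text{ for some }a\in A\}$. A fiber $Z=x*F_i$ splits with parity $(B,A)$ if $p_i^{n_i}\mid b-b'$ for all $b,b'\in\Sigma_B(Z)$ and $p_i^{n_i-1}\,\|\,a-a'$ ($p_i^{n_i-1}$ divides, $p_i^{n_i}$ does not) for all distinct $a,a'\in\Sigma_A(Z)$. -}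

module Defs where

open import Data.Nat using (ℕ; zero; suc; _+_; _*_; _∸_; _^_; _≤_; _<_; NonZero; ∣_-_∣)
open import Data.Nat.Properties using (m*n≢0; m^n≢0)
open import Data.Nat.DivMod using (_/_; _%_)
open import Data.Nat.Divisibility using (_∣_)
open import Data.Nat.Primality using (Prime; prime⇒nonZero)
open import Data.Fin using (Fin)
open import Data.List using (List; []; _∷_; map; allFin)
open import Data.Nat.ListAction using (product)
open import Data.Product using (Σ; _×_; ∃; ∃-syntax)
open import Relation.Nullary using (¬_)
open import Relation.Binary.PropositionalEquality using (_≡_; _≢_)
open import Function.Definitions using (Injective)

record Setup : Set where
  field
    K      : ℕ
    p      : Fin K → ℕ
    n      : Fin K → ℕ
    prime  : ∀ ν → Prime (p ν)
    distinct : Injective _≡_ _≡_ p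
    n-pos  : ∀ ν → 1 ≤ n ν

private
  prodNZ : ∀ {K} (f : Fin K → ℕ) → (∀ ν → NonZero (f ν)) → (xs : List (Fin K)) →
           NonZero (product (map f xs))
  prodNZ f nz [] = _
  prodNZ f nz (x ∷ xs) = m*n≢0 (f x) (product (map f xs)) {{nz x}} {{prodNZ f nz xs}}

module _ (S : Setup) where
  open Setup S

  M : ℕ
  M = product (map (λ ν → p ν ^ n ν) (allFin K))

  instance
    M-nonZero : NonZero M
    M-nonZero = prodNZ (λ ν → p ν ^ n ν)
                  (λ ν → m^n≢0 (p ν) (n ν) {{prime⇒nonZero (prime ν)}}) (allFin K)

  -- Z_M is represented by the naturals 0 ≤ x < M; addition is taken mod M.
  -- Subsets of Z_M are predicates on ℕ that only hold below M.
  SubsetZM : (ℕ → Set) → Set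
  SubsetZM X = ∀ x → X x → x < M

  record DirectSum (A B : ℕ → Set) : Set where
    field
      A⊆ZM : SubsetZM A
      B⊆ZM : SubsetZM B
      cover : ∀ x → x < M → ∃[ a ] ∃[ b ] (A a × B b × (a + b) % M ≡ x)
      unique : ∀ a b a' b' → A a → B b → A a' → B b' →
               (a + b) % M ≡ (a' + b') % M → a ≡ a' × b ≡ b'

  InFiber : (x : ℕ) (i : Fin K) → ℕ → Set
  InFiber x i z = ∃[ k ] (k < p i × z ≡ (x + k * ((M / p i) {{prime⇒nonZero (prime i)}})) % M)

  ΣA : (A B Z : ℕ → Set) → ℕ → Set
  ΣA A B Z a = A a × ∃[ b ] (B b × Z ((a + b) % M))

  ΣB : (A B Z : ℕ → Set) → ℕ → Set
  ΣB A B Z b = B b × ∃[ a ] (A a × Z ((a + b) % M))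

  -- p^k divides the difference a - a' of two elements of Z_M
  -- (representatives in [0,M); well defined since p^k ∣ M in all uses)
  DivDiff : ℕ → ℕ → ℕ → Set
  DivDiff d a a' = d ∣ ∣ a - a' ∣

  SplitsBA : (A B : ℕ → Set) (x : ℕ) (i : Fin K) → Set
  SplitsBA A B x i =
    (∀ b b' → ΣB A B (InFiber x i) b → ΣB A B (InFiber x i) b' →
       DivDiff (p i ^ n i) b b')
    × (∀ a a' → ΣA A B (InFiber x i) a → ΣA A B (InFiber x i) a' → a ≢ a' →
       DivDiff (p i ^ (n i ∸ 1)) a a' × ¬ DivDiff (p i ^ n i) a a')

{-# OPTIONS --safe #-}
-- Write M = p_i^{n_i} R with p_i ∤ R and Q = M/p_i.  If a + b = a₀ + kQ and a + b' = a₁ + k'Q,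
-- splitting gives p_i^{n_i} ∣ b, b', since 0 ∈ Σ_B(a_μ * F_i).  So modulo p_i^{n_i}
-- a₀ + kQ ≡ a ≡ a₁ + k'Q ≡ a₀ + k'Q, and as Q = p_i^{n_i-1} R this forces p_i ∣ k - k', i.e. k = k'.
-- Then a₁ + b = a₀ + b' in Z_M, and uniqueness in A ⊕ B gives a₀ = a₁.
module Submission where

open import Defs
open import Data.Nat using (ℕ; zero; suc; _+_; _*_; _∸_; _^_; _≤_; _<_; NonZero; ∣_-_∣; >-nonZero⁻¹)
open import Data.Fin using (Fin)
open import Data.Product using (_×_; ∃-syntax; _,_; proj₁)
open import Data.Empty using (⊥)
open import Relation.Binary.PropositionalEquality
  using (_≡_; _≢_; refl; sym; trans; cong; cong₂; subst; module ≡-Reasoning)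
open import Data.Nat.Properties
open import Data.Nat.DivMod using (_%_; _/_; m≡m%n+[m/n]*n; %-distribˡ-+; %-remove-+ʳ; %-congˡ; m∣n⇒o%n%m≡o%m; m/n*n≡m)
open import Data.Nat.Divisibility
open import Data.Nat.Primality using (Prime; prime⇒nonZero; prime⇒irreducible; euclidsLemma; ¬prime[1])
open import Data.Nat.ListAction using (product)
open import Data.List using (_∷_; map)
open import Data.List.Membership.Propositional using (_∈_)
open import Data.List.Membership.Propositional.Properties using (∈-allFin)
open import Data.List.Relation.Unary.Any using (here; there)
open import Data.List.Relation.Unary.All as All using (All; []; _∷_)
open import Data.List.Relation.Unary.All.Properties using (map⁺)
open import Data.List.Relation.Unary.AllPairs using (_∷_)
open import Data.List.Relation.Unary.Unique.Propositional using (Unique)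
open import Data.List.Relation.Unary.Unique.Propositional.Properties using (allFin⁺)
open import Data.Sum using ([_,_]′; inj₁; inj₂)
open import Function using (_∘_; id)
open import Relation.Nullary using (contradiction)
open import Algebra.Properties.CommutativeSemigroup +-commutativeSemigroup using ()
  renaming (x∙yz≈y∙xz to m+[n+o]≡n+[m+o])
open import Algebra.Properties.CommutativeSemigroup *-commutativeSemigroup using ()
  renaming (x∙yz≈y∙xz to m*[n*o]≡n*[m*o])
open ≡-Reasoning

m%d≡n%d⇒d∣∣m-n∣ : ∀ {m n} d .{{_ : NonZero d}} → m % d ≡ n % d → d ∣ ∣ m - n ∣
m%d≡n%d⇒d∣∣m-n∣ {m} {n} d eq = divides ∣ m / d - n / d ∣ (begin
    ∣ m - n ∣
      ≡⟨ cong₂ ∣_-_∣ (m≡m%n+[m/n]*n m d) (trans (m≡m%n+[m/n]*n n d) (cong (_+ n / d * d) (sym eq))) ⟩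
    ∣ m % d + m / d * d - m % d + n / d * d ∣
      ≡⟨ ∣m+n-m+o∣≡∣n-o∣ (m % d) (m / d * d) (n / d * d) ⟩
    ∣ m / d * d - n / d * d ∣
      ≡⟨ *-distribʳ-∣-∣ d (m / d) (n / d) ⟨
    ∣ m / d - n / d ∣ * d ∎)

m≤n⇒d∣n∸m⇒m%d≡n%d : ∀ {m n} d .{{_ : NonZero d}} → m ≤ n → d ∣ n ∸ m → m % d ≡ n % d
m≤n⇒d∣n∸m⇒m%d≡n%d {m} {n} d m≤n d∣n∸m = begin
  m % d             ≡⟨ %-remove-+ʳ m d∣n∸m ⟨
  (m + (n ∸ m)) % d ≡⟨ %-congˡ (m+[n∸m]≡n m≤n) ⟩
  n % d             ∎

d∣∣m-n∣⇒m%d≡n%d : ∀ {m n} d .{{_ : NonZero d}} → d ∣ ∣ m - n ∣ → m % d ≡ n % d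
d∣∣m-n∣⇒m%d≡n%d {m} {n} d d∣m-n with ≤-total m n
... | inj₁ m≤n = m≤n⇒d∣n∸m⇒m%d≡n%d d m≤n (subst (d ∣_) (m≤n⇒∣m-n∣≡n∸m m≤n) d∣m-n)
... | inj₂ n≤m = sym (m≤n⇒d∣n∸m⇒m%d≡n%d d n≤m
                       (subst (d ∣_) (trans (∣-∣-comm m n) (m≤n⇒∣m-n∣≡n∸m n≤m)) d∣m-n))

+-cong-% : ∀ {m n u v} d .{{_ : NonZero d}} → m % d ≡ n % d → u % d ≡ v % d → (m + u) % d ≡ (n + v) % d
+-cong-% {m} {n} {u} {v} d m≡n u≡v = begin
  (m + u) % d             ≡⟨ %-distribˡ-+ m u d ⟩
  (m % d + u % d) % d     ≡⟨ cong₂ (λ x y → (x + y) % d) m≡n u≡v ⟩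
  (n % d + v % d) % d     ≡⟨ %-distribˡ-+ n v d ⟨
  (n + v) % d             ∎

+-congˡ-% : ∀ {m n} o d .{{_ : NonZero d}} → m % d ≡ n % d → (o + m) % d ≡ (o + n) % d
+-congˡ-% o d = +-cong-% d refl

+-cancelˡ-% : ∀ {m n} o d .{{_ : NonZero d}} → (o + m) % d ≡ (o + n) % d → m % d ≡ n % d
+-cancelˡ-% {m} {n} o d eq =
  d∣∣m-n∣⇒m%d≡n%d d (subst (d ∣_) (∣m+n-m+o∣≡∣n-o∣ o m n) (m%d≡n%d⇒d∣∣m-n∣ d eq))

%-reduce : ∀ {m n} d e .{{_ : NonZero d}} .{{_ : NonZero e}} → d ∣ e → m % e ≡ n % e → m % d ≡ n % d
%-reduce {m} {n} d e d∣e eq = begin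
  m % d       ≡⟨ m∣n⇒o%n%m≡o%m d e m d∣e ⟨
  m % e % d   ≡⟨ cong (_% d) eq ⟩
  n % e % d   ≡⟨ m∣n⇒o%n%m≡o%m d e n d∣e ⟩
  n % d       ∎

exchange-% : ∀ {a b b' a₀ a₁ t} d .{{_ : NonZero d}} →
             (a + b) % d ≡ (a₀ + t) % d → (a + b') % d ≡ (a₁ + t) % d → (a₁ + b) % d ≡ (a₀ + b') % d
exchange-% {a} {b} {b'} {a₀} {a₁} {t} d e₀ e₁ = +-cancelˡ-% a d (begin
  (a + (a₁ + b)) % d    ≡⟨ cong (_% d) (m+[n+o]≡n+[m+o] a a₁ b) ⟩
  (a₁ + (a + b)) % d    ≡⟨ +-congˡ-% a₁ d e₀ ⟩
  (a₁ + (a₀ + t)) % d   ≡⟨ cong (_% d) (m+[n+o]≡n+[m+o] a₁ a₀ t) ⟩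
  (a₀ + (a₁ + t)) % d   ≡⟨ +-congˡ-% a₀ d e₁ ⟨
  (a₀ + (a + b')) % d   ≡⟨ cong (_% d) (m+[n+o]≡n+[m+o] a₀ a b') ⟩
  (a + (a₀ + b')) % d   ∎)

∣∧<⇒≡0 : ∀ {m n} → m ∣ n → n < m → n ≡ 0
∣∧<⇒≡0 {n = zero}  _   _   = refl
∣∧<⇒≡0 {n = suc _} m∣n n<m = contradiction m∣n (>⇒∤ n<m)

m∣m^n : ∀ {m n} → 1 ≤ n → m ∣ m ^ n
m∣m^n {m} {suc n} _ = m∣m*n (m ^ n)

module _ {p : ℕ} (p-prime : Prime p) where

  prime∤1 : p ∤ 1
  prime∤1 p∣1 = ¬prime[1] (subst Prime (∣1⇒≡1 p∣1) p-prime)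

  prime∤* : ∀ {m n} → p ∤ m → p ∤ n → p ∤ m * n
  prime∤* p∤m p∤n p∣m*n = [ p∤m , p∤n ]′ (euclidsLemma _ _ p-prime p∣m*n)

  prime∤^ : ∀ {m} → p ∤ m → ∀ e → p ∤ m ^ e
  prime∤^ p∤m zero    = prime∤1
  prime∤^ p∤m (suc e) = prime∤* p∤m (prime∤^ p∤m e)

  prime∤product : ∀ {ms} → All (p ∤_) ms → p ∤ product ms
  prime∤product []            = prime∤1
  prime∤product (p∤m ∷ p∤ms) = prime∤* p∤m (prime∤product p∤ms)

  prime∤prime : ∀ {r} → Prime r → p ≢ r → p ∤ r
  prime∤prime r-prime p≢r p∣r =
    [ (λ p≡1 → ¬prime[1] (subst Prime p≡1 p-prime)) , p≢r ]′ (prime⇒irreducible r-prime p∣r)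

  -- The hypotheses describe Q = M/p where q is the exact power of p dividing M = q R.
  *-cancelʳ-%-below-prime : ∀ {q R Q k k'} .{{_ : NonZero q}} → Q * p ≡ q * R → p ∤ R →
                           k < p → k' < p → (k * Q) % q ≡ (k' * Q) % q → k ≡ k'
  *-cancelʳ-%-below-prime {q} {R} {Q} {k} {k'} Q*p≡q*R p∤R k<p k'<p kQ≡k'Q =
    ∣m-n∣≡0⇒m≡n (∣∧<⇒≡0 p∣d d<p)
    where
    d : ℕ
    d = ∣ k - k' ∣
    q∣d*Q : q ∣ d * Q
    q∣d*Q = subst (q ∣_) (sym (*-distribʳ-∣-∣ Q k k')) (m%d≡n%d⇒d∣∣m-n∣ q kQ≡k'Q)
    d*Q*p≡q*[d*R] : d * Q * p ≡ q * (d * R)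
    d*Q*p≡q*[d*R] = begin
      d * Q * p    ≡⟨ *-assoc d Q p ⟩
      d * (Q * p)  ≡⟨ cong (d *_) Q*p≡q*R ⟩
      d * (q * R)  ≡⟨ m*[n*o]≡n*[m*o] d q R ⟩
      q * (d * R)  ∎
    p∣d*R : p ∣ d * R
    p∣d*R = *-cancelˡ-∣ q (subst (q * p ∣_) d*Q*p≡q*[d*R] (*-monoˡ-∣ p q∣d*Q))
    p∣d : p ∣ d
    p∣d = [ id , (λ p∣R → contradiction p∣R p∤R) ]′ (euclidsLemma d R p-prime p∣d*R)
    d<p : d < p
    d<p = ≤-<-trans (∣m-n∣≤m⊔n k k') (⊔-lub k<p k'<p)

module Fiber (S : Setup) (i : Fin (Setup.K S)) where
  open Setup S

  instance
    p-nonZero : NonZero (p i)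
    p-nonZero = prime⇒nonZero (prime i)
    q-nonZero : NonZero (p i ^ n i)
    q-nonZero = m^n≢0 (p i) (n i)
    M-nonZero′ : NonZero (M S)
    M-nonZero′ = M-nonZero S

  q Q : ℕ
  q = p i ^ n i
  Q = M S / p i

  p∤p^n : ∀ {ν} → i ≢ ν → p i ∤ p ν ^ n ν
  p∤p^n {ν} i≢ν = prime∤^ (prime i) (prime∤prime (prime i) (prime ν) (i≢ν ∘ distinct)) (n ν)

  product-p^n-split : ∀ {νs} → Unique νs → i ∈ νs →
                      ∃[ R ] (product (map (λ ν → p ν ^ n ν) νs) ≡ q * R × p i ∤ R)
  product-p^n-split {_ ∷ νs} (i∉νs ∷ _) (here refl) =
    product (map (λ ν → p ν ^ n ν) νs) , refl , prime∤product (prime i) (map⁺ (All.map p∤p^n i∉νs))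
  product-p^n-split {ν ∷ _} (ν∉νs ∷ unique) (there i∈νs) with product-p^n-split unique i∈νs
  ... | R , eq , p∤R = p ν ^ n ν * R
                     , trans (cong (p ν ^ n ν *_) eq) (m*[n*o]≡n*[m*o] (p ν ^ n ν) q R)
                     , prime∤* (prime i) (p∤p^n (All.lookup ν∉νs i∈νs ∘ sym)) p∤R

  M-split : ∃[ R ] (M S ≡ q * R × p i ∤ R)
  M-split = product-p^n-split (allFin⁺ K) (∈-allFin i)

  q∣M : q ∣ M S
  q∣M with M-split
  ... | R , M≡q*R , _ = divides R (trans M≡q*R (*-comm q R))

  Q*p≡M : Q * p i ≡ M S
  Q*p≡M = m/n*n≡m (∣-trans (m∣m^n (n-pos i)) q∣M)

  fiber-offset-injective : ∀ {k k'} → k < p i → k' < p i → (k * Q) % q ≡ (k' * Q) % q → k ≡ k'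
  fiber-offset-injective with M-split
  ... | R , M≡q*R , p∤R = *-cancelʳ-%-below-prime (prime i) (trans Q*p≡M M≡q*R) p∤R

  split⇒residue : ∀ {A B x a b k} → SplitsBA S A B x i → A x → B 0 → A a → B b → k < p i →
                  (a + b) % M S ≡ (x + k * Q) % M S → (x + k * Q) % q ≡ a % q
  split⇒residue {x = x} {a} {b} {k} split Ax B0 Aa Bb k<p a+b≡x+kQ = begin
    (x + k * Q) % q  ≡⟨ %-reduce q (M S) q∣M a+b≡x+kQ ⟨
    (a + b) % q      ≡⟨ +-congˡ-% a q b≡0 ⟩
    (a + 0) % q      ≡⟨ cong (_% q) (+-identityʳ a) ⟩
    a % q            ∎
    where
    -- 0 ∈ Σ_B(x * F_i), witnessed by x + 0 = x + 0 · M/p_i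
    b≡0 : b % q ≡ 0 % q
    b≡0 = d∣∣m-n∣⇒m%d≡n%d q (proj₁ split b 0 (Bb , a , Aa , k , k<p , a+b≡x+kQ)
                                              (B0 , x , Ax , 0 , >-nonZero⁻¹ (p i) , refl))

lemma4p7 : (S : Setup) (A B : ℕ → Set) → DirectSum S A B → (i : Fin (Setup.K S)) →
           B 0 → (a₀ a₁ : ℕ) → A a₀ → A a₁ → a₀ ≢ a₁ →
           DivDiff S (Setup.p S i ^ Setup.n S i) a₀ a₁ →
           SplitsBA S A B a₀ i → SplitsBA S A B a₁ i →
           ∀ a → ΣA S A B (InFiber S a₀ i) a → ΣA S A B (InFiber S a₁ i) a → ⊥
lemma4p7 S A B A⊕B i B0 a₀ a₁ Aa₀ Aa₁ a₀≢a₁ q∣a₀-a₁ split₀ split₁ a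
  (Aa , b , Bb , k , k<p , a+b≡a₀+kQ) (_ , b' , Bb' , k' , k'<p , a+b'≡a₁+k'Q) =
  a₀≢a₁ (sym (proj₁ (unique a₁ b a₀ b' Aa₁ Bb Aa₀ Bb' a₁+b≡a₀+b')))
  where
  open DirectSum A⊕B using (unique)
  open Fiber S i
  k≡k' : k ≡ k'
  k≡k' = fiber-offset-injective k<p k'<p (+-cancelˡ-% a₀ q (begin
    (a₀ + k * Q) % q   ≡⟨ split⇒residue split₀ Aa₀ B0 Aa Bb k<p a+b≡a₀+kQ ⟩
    a % q              ≡⟨ split⇒residue split₁ Aa₁ B0 Aa Bb' k'<p a+b'≡a₁+k'Q ⟨
    (a₁ + k' * Q) % q  ≡⟨ +-cong-% q (d∣∣m-n∣⇒m%d≡n%d {a₀} {a₁} q q∣a₀-a₁) refl ⟨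
    (a₀ + k' * Q) % q  ∎))
  a+b'≡a₁+kQ : (a + b') % M S ≡ (a₁ + k * Q) % M S
  a+b'≡a₁+kQ = subst (λ t → (a + b') % M S ≡ (a₁ + t * Q) % M S) (sym k≡k') a+b'≡a₁+k'Q
  a₁+b≡a₀+b' : (a₁ + b) % M S ≡ (a₀ + b') % M S
  a₁+b≡a₀+b' = exchange-% {a = a} (M S) a+b≡a₀+kQ a+b'≡a₁+kQ
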